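{- Let $s,k$ be positive integers and $\epsilon\in(0,1)$. Then for all sufficiently large $n$ there exist $A,B\subseteq\mathbb{Z}$ with $|A|=|B|=n$ and $|A+B|>kn$ such that for every subset $B_{(s)}\subseteq B$ with $|B_{(s)}|\le s$ we have $|A+B_{(s)}|\le(2+\epsilon)n$.
   Context: $X+Y=\{x+y:x\in X,y\in Y\}$.
   Formalization: The parameter $\epsilon$ ranges only over the rationals in $(0,1)$. -}

module Defs where

open import Data.Nat using (ℕ)
open import Data.Integer using (ℤ; _+_; _≟_)
open import Data.List using (List; length; deduplicate; cartesianProductWith)
open import Data.List.Relation.Unary.Unique.Propositional using (Unique)

-- A finite subset of ℤ is represented by a duplicate-free list (Unique).
-- Its cardinality is the length of the list.

sumset : List ℤ → List ℤ → List ℤ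
sumset X Y = deduplicate _≟_ (cartesianProductWith _+_ X Y)

sumsetCard : List ℤ → List ℤ → ℕ
sumsetCard X Y = length (sumset X Y)

{-# OPTIONS --safe #-}
module Submission where

-- Take m = k + 1, A = {n, 2n, …, mn} ∪ {0, …, n − m − 1} and B = {0, …, n − 1}.
-- Writing t − n = qn + i with i < n, each t ∈ [n, (m + 1)n) is n(1 + q) + i, so |A + B| ≥ mn > kn.
-- For B′ ⊆ B the sums from the short block lie in [0, 2n), and at most m|B′| sums use a
-- multiple of n, so |A + B′| ≤ 2n + ms; writing ε = (1 + p)/(1 + d), this is at most
-- (2 + ε)n as soon as n ≥ ms(1 + d).

open import Defs
open import Data.Nat using (ℕ; _≥_; _>_; _≤_; _*_)
open import Data.Integer using (ℤ; +_)
open import Data.Rational using (ℚ; 0ℚ; 1ℚ; _/_) renaming (_<_ to _<ℚ_; _≤_ to _≤ℚ_; _+_ to _+ℚ_; _*_ to _*ℚ_)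
open import Data.List using (List; length)
open import Data.List.Relation.Unary.Unique.Propositional using (Unique)
open import Data.List.Relation.Binary.Subset.Propositional using (_⊆_)
open import Data.Product using (Σ; ∃; _×_)
open import Relation.Binary.PropositionalEquality using (_≡_)

open import Level using (Level)
open import Data.Nat using (zero; suc; _+_; _∸_; _<_; s≤s; z≤n; z<s; NonZero; >-nonZero)
open import Data.Nat.Properties
  using (+-cancelˡ-≡; *-cancelˡ-≡; m≤m*n; suc-injective; m+[n∸m]≡n; m∸n≤m; m≤m+n; m<n+m;
         m+n≤o⇒m≤o; m+n≤o⇒n≤o; ≤-trans; <-≤-trans; <-irrefl; +-mono-<; +-monoʳ-≤;
         *-monoˡ-≤; *-monoʳ-≤; *-distribʳ-+; *-identityʳ; +-identityʳ; module ≤-Reasoning)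
open import Data.Nat.DivMod using (_%_; _div_; m≡m%n+[m/n]*n; m%n<n; m<n*o⇒m/o<n)
open import Data.Nat.Coprimality using (Coprime; 1-coprimeTo)
import Data.Nat.Coprimality as Coprime
open import Data.Nat.Solver using (module +-*-Solver)
import Data.Integer as ℤ
import Data.Integer.Properties as ℤ
open import Data.Rational using (mkℚ; toℚᵘ; positive)
import Data.Rational.Properties as ℚ
open import Data.Rational.Unnormalised as ℚᵘ using (ℚᵘ; mkℚᵘ; *≤*)
import Data.Rational.Unnormalised.Properties as ℚᵘ
open import Data.List using ([]; _∷_; map; upTo; _++_; cartesianProductWith)
open import Data.List.Properties using (length-map; length-++; length-upTo; length-removeAt′)
open import Data.List.Membership.Propositional using (_∈_)
open import Data.List.Membership.Propositional.Properties
  using (∈-map⁺; ∈-map⁻; ∈-++⁺ˡ; ∈-++⁺ʳ; ∈-++⁻; ∈-upTo⁺; ∈-upTo⁻;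
         ∈-cartesianProductWith⁺; ∈-cartesianProductWith⁻; ∈-deduplicate⁺; ∈-deduplicate⁻)
open import Data.List.Relation.Unary.Any using (here; there; index; _─_)
open import Data.List.Relation.Unary.All using (lookup)
open import Data.List.Relation.Unary.AllPairs using (_∷_)
import Data.List.Relation.Unary.Unique.Propositional.Properties as Unique
open import Data.List.Relation.Unary.Unique.DecPropositional.Properties using (deduplicate-!)
open import Data.Product using (_,_)
open import Data.Sum using (inj₁; inj₂)
open import Relation.Nullary using (¬_; contradiction)
open import Relation.Binary.PropositionalEquality using (refl; sym; trans; cong; cong₂; subst; subst₂; _≢_; module ≡-Reasoning)

private
  variable
    a : Level
    X Y Z : Set a

∈-─⁺ : ∀ {x y} {ys : List X} (x∈ys : x ∈ ys) → y ∈ ys → x ≢ y → y ∈ (ys ─ x∈ys)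
∈-─⁺ (here refl) (here refl) x≢y = contradiction refl x≢y
∈-─⁺ (here _)    (there y∈ys) _  = y∈ys
∈-─⁺ (there _)   (here y≡z)   _  = here y≡z
∈-─⁺ (there x∈ys) (there y∈ys) x≢y = there (∈-─⁺ x∈ys y∈ys x≢y)

Unique-⊆⇒length≤ : {xs ys : List X} → Unique xs → xs ⊆ ys → length xs ≤ length ys
Unique-⊆⇒length≤ {xs = []}     _              _     = z≤n
Unique-⊆⇒length≤ {xs = x ∷ xs} {ys} (x∉xs ∷ u) xs⊆ys =
  subst (suc (length xs) ≤_) (sym (length-removeAt′ ys (index x∈ys)))
    (s≤s (Unique-⊆⇒length≤ u (λ y∈xs → ∈-─⁺ x∈ys (xs⊆ys (there y∈xs)) (lookup x∉xs y∈xs))))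
  where x∈ys = xs⊆ys (here refl)

length-cartesianProductWith : ∀ (f : X → Y → Z) xs ys →
  length (cartesianProductWith f xs ys) ≡ length xs * length ys
length-cartesianProductWith f []       ys = refl
length-cartesianProductWith f (x ∷ xs) ys =
  trans (length-++ (map (f x) ys)) (cong₂ _+_ (length-map (f x) ys) (length-cartesianProductWith f xs ys))

∈-sumset⁺ : ∀ {X Y x y} → x ∈ X → y ∈ Y → x ℤ.+ y ∈ sumset X Y
∈-sumset⁺ x∈X y∈Y = ∈-deduplicate⁺ ℤ._≟_ (∈-cartesianProductWith⁺ ℤ._+_ x∈X y∈Y)

∈-sumset⁻ : ∀ X Y {z} → z ∈ sumset X Y → ∃ λ x → ∃ λ y → x ∈ X × y ∈ Y × z ≡ x ℤ.+ y
∈-sumset⁻ X Y z∈X+Y = ∈-cartesianProductWith⁻ ℤ._+_ X Y (∈-deduplicate⁻ ℤ._≟_ _ z∈X+Y)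

sumset⊆⇒sumsetCard≤ : ∀ X Y {Z} → sumset X Y ⊆ Z → sumsetCard X Y ≤ length Z
sumset⊆⇒sumsetCard≤ X Y = Unique-⊆⇒length≤ (deduplicate-! ℤ._≟_ _)

module Construction (n m : ℕ) .{{_ : NonZero n}} (m≤n : m ≤ n) where

  multiples : List ℕ
  multiples = map (λ j → n * suc j) (upTo m)

  A : List ℤ
  A = map +_ (multiples ++ upTo (n ∸ m))

  B : List ℤ
  B = map +_ (upTo n)

  n≤multiple : ∀ {a} → a ∈ multiples → n ≤ a
  n≤multiple a∈ with j , _ , refl ← ∈-map⁻ _ a∈ = m≤m*n n (suc j)

  Unique-A : Unique A
  Unique-A = Unique.map⁺ ℤ.+-injective (Unique.++⁺ Unique-multiples (Unique.upTo⁺ (n ∸ m)) disjoint)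
    where
    Unique-multiples : Unique multiples
    Unique-multiples = Unique.map⁺ (λ {i} {j} eq → suc-injective (*-cancelˡ-≡ (suc i) (suc j) n eq)) (Unique.upTo⁺ m)
    disjoint : ∀ {a} → ¬ (a ∈ multiples × a ∈ upTo (n ∸ m))
    disjoint (a∈M , a∈I) = <-irrefl refl (<-≤-trans (∈-upTo⁻ a∈I) (≤-trans (m∸n≤m n m) (n≤multiple a∈M)))

  Unique-B : Unique B
  Unique-B = Unique.map⁺ ℤ.+-injective (Unique.upTo⁺ n)

  length-A : length A ≡ n
  length-A = begin
    length A                                   ≡⟨ length-map +_ (multiples ++ _) ⟩
    length (multiples ++ upTo (n ∸ m))         ≡⟨ length-++ multiples ⟩
    length multiples + length (upTo (n ∸ m))   ≡⟨ cong₂ _+_ (trans (length-map _ (upTo m)) (length-upTo m)) (length-upTo (n ∸ m)) ⟩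
    m + (n ∸ m)                                ≡⟨ m+[n∸m]≡n m≤n ⟩
    n                                          ∎
    where open ≡-Reasoning

  length-B : length B ≡ n
  length-B = trans (length-map +_ (upTo n)) (length-upTo n)

  interval : List ℤ
  interval = map (λ t → + (n + t)) (upTo (m * n))

  interval⊆A+B : interval ⊆ sumset A B
  interval⊆A+B z∈I with t , t∈ , refl ← ∈-map⁻ _ z∈I =
    subst (_∈ sumset A B) (cong +_ n*[1+q]+i≡n+t) (∈-sumset⁺ multiple∈A i∈B)
    where
    q = t div n
    i = t % n
    multiple∈A : + (n * suc q) ∈ A
    multiple∈A = ∈-map⁺ +_ (∈-++⁺ˡ (∈-map⁺ (λ j → n * suc j) (∈-upTo⁺ (m<n*o⇒m/o<n {n = m} (∈-upTo⁻ t∈)))))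
    i∈B : + i ∈ B
    i∈B = ∈-map⁺ +_ (∈-upTo⁺ (m%n<n t n))
    n*[1+q]+i≡n+t : n * suc q + i ≡ n + t
    n*[1+q]+i≡n+t = trans (solve 3 (λ n q i → n :* (con 1 :+ q) :+ i := n :+ (i :+ q :* n)) refl n q i)
                          (cong (_+_ n) (sym (m≡m%n+[m/n]*n t n)))
      where open +-*-Solver

  m*n≤sumsetCard-A-B : m * n ≤ sumsetCard A B
  m*n≤sumsetCard-A-B = subst (_≤ sumsetCard A B) length-interval (Unique-⊆⇒length≤ Unique-interval interval⊆A+B)
    where
    Unique-interval : Unique interval
    Unique-interval = Unique.map⁺ (λ eq → +-cancelˡ-≡ n _ _ (ℤ.+-injective eq)) (Unique.upTo⁺ (m * n))
    length-interval : length interval ≡ m * n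
    length-interval = trans (length-map _ (upTo (m * n))) (length-upTo (m * n))

  covering : List ℤ → List ℤ
  covering Bs = map +_ (upTo (2 * n)) ++ cartesianProductWith ℤ._+_ (map +_ multiples) Bs

  A+Bs⊆covering : ∀ {Bs} → Bs ⊆ B → sumset A Bs ⊆ covering Bs
  A+Bs⊆covering {Bs} Bs⊆B z∈A+Bs with a , b , a∈A , b∈Bs , refl ← ∈-sumset⁻ A Bs z∈A+Bs
                                   with a′ , a′∈ , refl ← ∈-map⁻ +_ a∈A
                                   with ∈-++⁻ multiples a′∈
  ... | inj₁ a′∈M = ∈-++⁺ʳ _ (∈-cartesianProductWith⁺ ℤ._+_ (∈-map⁺ +_ a′∈M) b∈Bs)
  ... | inj₂ a′∈I with b′ , b′∈ , refl ← ∈-map⁻ +_ (Bs⊆B b∈Bs) =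
    ∈-++⁺ˡ (∈-map⁺ +_ (∈-upTo⁺ a′+b′<2n))
    where
    a′+b′<2n : a′ + b′ < 2 * n
    a′+b′<2n = subst (a′ + b′ <_) (cong (_+_ n) (sym (+-identityʳ n)))
      (+-mono-< (<-≤-trans (∈-upTo⁻ a′∈I) (m∸n≤m n m)) (∈-upTo⁻ b′∈))

  length-covering : ∀ Bs → length (covering Bs) ≡ 2 * n + m * length Bs
  length-covering Bs = begin
    length (covering Bs)                                        ≡⟨ length-++ (map +_ (upTo (2 * n))) ⟩
    length (map +_ (upTo (2 * n))) + length (cartesianProductWith ℤ._+_ (map +_ multiples) Bs)
      ≡⟨ cong₂ _+_ (trans (length-map +_ (upTo (2 * n))) (length-upTo (2 * n)))
                   (length-cartesianProductWith ℤ._+_ (map +_ multiples) Bs) ⟩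
    2 * n + length (map +_ multiples) * length Bs               ≡⟨ cong (λ l → 2 * n + l * length Bs) length-multiples ⟩
    2 * n + m * length Bs                                       ∎
    where
    open ≡-Reasoning
    length-multiples : length (map +_ multiples) ≡ m
    length-multiples = trans (length-map +_ multiples) (trans (length-map _ (upTo m)) (length-upTo m))

  sumsetCard-A-≤2*n+m*length : ∀ {Bs} → Bs ⊆ B → sumsetCard A Bs ≤ 2 * n + m * length Bs
  sumsetCard-A-≤2*n+m*length {Bs} Bs⊆B =
    subst (sumsetCard A Bs ≤_) (length-covering Bs) (sumset⊆⇒sumsetCard≤ A Bs (A+Bs⊆covering Bs⊆B))

c≤2n+x⇒c[1+d]≤[2[1+d]+1+p]n : ∀ {c x} n d p → c ≤ 2 * n + x → x * suc d ≤ n →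
  c * suc d ≤ (2 * suc d + suc p) * n
c≤2n+x⇒c[1+d]≤[2[1+d]+1+p]n {c} {x} n d p c≤ x[1+d]≤n = begin
  c * suc d                        ≤⟨ *-monoˡ-≤ (suc d) c≤ ⟩
  (2 * n + x) * suc d              ≡⟨ solve 3 (λ n x d → (con 2 :* n :+ x) :* (con 1 :+ d) := con 2 :* (con 1 :+ d) :* n :+ x :* (con 1 :+ d)) refl n x d ⟩
  2 * suc d * n + x * suc d        ≤⟨ +-monoʳ-≤ (2 * suc d * n) x[1+d]≤n ⟩
  2 * suc d * n + n                ≤⟨ +-monoʳ-≤ (2 * suc d * n) (m≤m+n n (p * n)) ⟩
  2 * suc d * n + suc p * n        ≡⟨ *-distribʳ-+ n (2 * suc d) (suc p) ⟨
  (2 * suc d + suc p) * n          ∎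
  where
  open ≤-Reasoning
  open +-*-Solver

toℚᵘ-fromℕ : ∀ n → toℚᵘ (+ n / 1) ℚᵘ.≃ mkℚᵘ (+ n) 0
toℚᵘ-fromℕ n = ℚᵘ.≃-reflexive (cong toℚᵘ (ℚ.normalize-coprime (Coprime.sym (1-coprimeTo n))))

cleared⇒≤[2+p/[1+d]]n : ∀ c n p d .(cop : Coprime p (suc d)) → c * suc d ≤ (2 * suc d + p) * n →
  (+ c / 1) ≤ℚ ((+ 2 / 1) +ℚ mkℚ (+ p) d cop) *ℚ (+ n / 1)
cleared⇒≤[2+p/[1+d]]n c n p d cop c[1+d]≤ =
  ℚ.toℚᵘ-cancel-≤ (ℚᵘ.≤-respʳ-≃ (ℚᵘ.≃-sym toℚᵘ-rhs) (ℚᵘ.≤-respˡ-≃ (ℚᵘ.≃-sym (toℚᵘ-fromℕ c)) unnormalised))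
  where
  rhsᵘ : ℚᵘ
  rhsᵘ = (mkℚᵘ (+ 2) 0 ℚᵘ.+ mkℚᵘ (+ p) d) ℚᵘ.* mkℚᵘ (+ n) 0
  toℚᵘ-rhs : toℚᵘ (((+ 2 / 1) +ℚ mkℚ (+ p) d cop) *ℚ (+ n / 1)) ℚᵘ.≃ rhsᵘ
  toℚᵘ-rhs = ℚᵘ.≃-trans (ℚ.toℚᵘ-homo-* ((+ 2 / 1) +ℚ mkℚ (+ p) d cop) (+ n / 1))
    (ℚᵘ.*-cong (ℚᵘ.≃-trans (ℚ.toℚᵘ-homo-+ (+ 2 / 1) (mkℚ (+ p) d cop)) (ℚᵘ.+-cong (toℚᵘ-fromℕ 2) (ℚᵘ.≃-refl {mkℚᵘ (+ p) d}))) (toℚᵘ-fromℕ n))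
  unnormalised : mkℚᵘ (+ c) 0 ℚᵘ.≤ rhsᵘ
  unnormalised = *≤* (subst₂ ℤ._≤_ lhs-cleared rhs-cleared (ℤ.+≤+ c[1+d]≤))
    where
    lhs-cleared : + (c * suc d) ≡ + c ℤ.* ℚᵘ.↧ rhsᵘ
    lhs-cleared = trans (ℤ.pos-* c (suc d))
      (cong (λ x → + c ℤ.* + suc x) (sym (trans (*-identityʳ (d + 0)) (+-identityʳ d))))
    rhs-cleared : + ((2 * suc d + p) * n) ≡ ℚᵘ.↥ rhsᵘ ℤ.* + 1
    rhs-cleared = begin
      + ((2 * suc d + p) * n)                         ≡⟨ ℤ.pos-* (2 * suc d + p) n ⟩
      (+ (2 * suc d) ℤ.+ + p) ℤ.* + n                 ≡⟨ cong₂ (λ a b → (a ℤ.+ b) ℤ.* + n) (ℤ.pos-* 2 (suc d)) (sym (ℤ.*-identityʳ (+ p))) ⟩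
      (+ 2 ℤ.* + suc d ℤ.+ + p ℤ.* + 1) ℤ.* + n       ≡⟨ ℤ.*-identityʳ _ ⟨
      (+ 2 ℤ.* + suc d ℤ.+ + p ℤ.* + 1) ℤ.* + n ℤ.* + 1 ∎
      where open ≡-Reasoning

proposition2p5 : (s k : ℕ) → s ≥ 1 → k ≥ 1 → (ε : ℚ) → 0ℚ <ℚ ε → ε <ℚ 1ℚ →
    ∃ λ (N : ℕ) → ∀ (n : ℕ) → n ≥ N →
      Σ (List ℤ) λ A → Σ (List ℤ) λ B →
        Unique A × Unique B × length A ≡ n × length B ≡ n ×
        sumsetCard A B > k * n ×
        (∀ (Bs : List ℤ) → Unique Bs → Bs ⊆ B → length Bs ≤ s →
          ((+ sumsetCard A Bs) / 1) ≤ℚ (((+ 2) / 1) +ℚ ε) *ℚ ((+ n) / 1))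
proposition2p5 s k _ _ (mkℚ ℤ.-[1+ _ ] _ _) 0<ε _ with () ← positive 0<ε
proposition2p5 s k _ _ (mkℚ (+ zero) _ _)   0<ε _ with () ← positive 0<ε
proposition2p5 s k _ _ (mkℚ (+ suc p) d cop) _  _ = m + m * s * suc d , λ n n≥N →
  let m≤n = m+n≤o⇒m≤o m n≥N
      0<n = <-≤-trans z<s m≤n
      open Construction n m {{>-nonZero 0<n}} m≤n
  in A , B , Unique-A , Unique-B , length-A , length-B ,
     <-≤-trans (m<n+m (k * n) 0<n) m*n≤sumsetCard-A-B ,
     λ Bs _ Bs⊆B |Bs|≤s → cleared⇒≤[2+p/[1+d]]n (sumsetCard A Bs) n (suc p) d cop
       (c≤2n+x⇒c[1+d]≤[2[1+d]+1+p]n n d p (sumsetCard-A-≤2*n+m*length Bs⊆B)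
         (≤-trans (*-monoˡ-≤ (suc d) (*-monoʳ-≤ m |Bs|≤s)) (m+n≤o⇒n≤o m n≥N)))
  where m = suc k
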